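{- Let $\mathcal{I}$ be an instance of the extended version with $|U(\mathcal{I})|=q$ and let $\mathcal{F}$ be a universal set of feasible assignments for $\mathcal{I}$. Let $f$ be any feasible assignment for $\mathcal{I}$ (not necessarily in $\mathcal{F}$) and $j\in[q]$ a worker; for each $r\in\mathbb{Z}_{>0}$ let $i_r$ be the unique element of $U(\mathcal{I})$ with $f(i_r,r)=j$. Then for every $r$ there is an arc from $i_r$ to $i_{r+1}$ in $D^{\mathcal{I},\mathcal{F}}$; that is, the sequence $i_1,i_2,\ldots$ of tasks of $U(\mathcal{I})$ performed by $j$ is a walk in $D^{\mathcal{I},\mathcal{F}}$.
   Context: Tasks: $n$ intervals $[s_i,e_i)\subseteq(-1,1)$, $i\in[n]$, with $e_i\in(0,1]$, $e_i-s_i\le 1$; the $r$th occurrence of task $i$ occupies $[s_i+r,e_i+r)$; workers are $[q]$. $U(\mathcal{I})=\{i\in[n]: s_i\le 0\}$. A schedule is a pair $(T,W)$ with $T\subseteq[n]$ and $W=\varnothing$ or $W=\{i\}$, $i\in U(\mathcal{I})$; it is non-overlapping if for all $i'\in T$: $[s_{i'},e_{i'})\cap[s_{i''},e_{i''})=\varnothing$ for $i''\in T\setminus\{i'\}$ and $[s_{i'},e_{i'})\cap[s_i+1,e_i+1)=\varnothing$ for $i\in W$. An extended instance is $\bigl(([s_i,e_i))_{i\in[n]},q,\mathcal{S}\bigr)$ with $\mathcal{S}$ a set of non-overlapping schedules. An assignment $f:[n]\times\mathbb{Z}_{>0}\to[q]$ induces, for worker $j$ and week $r\in\mathbb{Z}_{>0}$,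 the schedule $(\{i: f(i,r)=j\},\{i\in U(\mathcal{I}): f(i,r+1)=j\})$; $f$ is feasible if all induced schedules lie in $\mathcal{S}$. When $|U(\mathcal{I})|=q$ and $f$ is feasible, $i\mapsto f(i,r)$ is a bijection $U(\mathcal{I})\to[q]$ for each $r$. For a set $\mathcal{F}$ of feasible assignments, $D^{\mathcal{I},\mathcal{F}}$ is the directed multigraph with vertex set $U(\mathcal{I})$ having, for each $f\in\mathcal{F}$ and each $i\in U(\mathcal{I})$, one arc labeled $f$ from $i$ to the unique $i'\in U(\mathcal{I})$ with $f(i,1)=f(i',2)$. The set $\mathcal{F}$ is universal if whenever some feasible assignment $f$ satisfies $f(i,1)=f(i',2)$ for $i,i'\in U(\mathcal{I})$, some $g\in\mathcal{F}$ satisfies $g(i,1)=g(i',2)$.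
   Formalization: The interval endpoints $s_i$ and $e_i$ are rational numbers. -}

module Defs where

open import Data.Nat using (ℕ; zero; suc; _≤_)
open import Data.Fin using (Fin; _≟_)
open import Data.Fin.Subset using (Subset; _∈_; ⊥; ⁅_⁆; ∣_∣)
open import Data.Bool using (Bool; _∧_)
open import Data.Vec using (tabulate)
open import Data.Rational using (ℚ; 0ℚ; 1ℚ; -_; _+_; _-_)
  renaming (_≤_ to _≤ℚ_; _<_ to _<ℚ_)
open import Data.Rational.Properties using () renaming (_≤?_ to _≤ℚ?_)
open import Data.Product using (Σ; Σ-syntax; _×_; ∃)
open import Data.Sum using (_⊎_)
open import Relation.Nullary using (¬_)
open import Relation.Nullary.Decidable using (⌊_⌋)
open import Relation.Binary.PropositionalEquality using (_≡_)

Disjoint : ℚ → ℚ → ℚ → ℚ → Set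
Disjoint a b c d = ¬ (Σ[ x ∈ ℚ ] ((a ≤ℚ x × x <ℚ b) × (c ≤ℚ x × x <ℚ d)))

record Tasks (n : ℕ) : Set where
  field
    s : Fin n → ℚ
    e : Fin n → ℚ
    s>-1   : ∀ i → (- 1ℚ) <ℚ s i
    e>0    : ∀ i → 0ℚ <ℚ e i
    e≤1    : ∀ i → e i ≤ℚ 1ℚ
    len≤1  : ∀ i → (e i - s i) ≤ℚ 1ℚ

  U : Subset n
  U = tabulate (λ i → ⌊ s i ≤ℚ? 0ℚ ⌋)

  IsSchedule : Subset n → Subset n → Set
  IsSchedule T W = (W ≡ ⊥) ⊎ (Σ[ i ∈ Fin n ] (i ∈ U × W ≡ ⁅ i ⁆))

  NonOverlapping : Subset n → Subset n → Set
  NonOverlapping T W =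
    ∀ i' → i' ∈ T →
      (∀ i'' → i'' ∈ T → ¬ (i'' ≡ i') → Disjoint (s i') (e i') (s i'') (e i''))
      × (∀ i → i ∈ W → Disjoint (s i') (e i') (s i + 1ℚ) (e i + 1ℚ))

record ExtInstance : Set₁ where
  field
    n : ℕ
    tasks : Tasks n
    q : ℕ
    S : Subset n → Subset n → Set
    S-sched : ∀ T W → S T W → Tasks.IsSchedule tasks T W × Tasks.NonOverlapping tasks T W

  open Tasks tasks public

  -- Assignments f : [n] × ℤ_{>0} → [q]; week r is represented by the natural r,
  -- the value at 0 is irrelevant (never used).
  Assignment : Set
  Assignment = Fin n → ℕ → Fin q

  inducedT : Assignment → Fin q → ℕ → Subset n
  inducedT f j r = tabulate (λ i → ⌊ f i r ≟ j ⌋)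

  inducedW : Assignment → Fin q → ℕ → Subset n
  inducedW f j r = tabulate (λ i → ⌊ s i ≤ℚ? 0ℚ ⌋ ∧ ⌊ f i (suc r) ≟ j ⌋)

  Feasible : Assignment → Set
  Feasible f = ∀ (j : Fin q) (r : ℕ) → 1 ≤ r → S (inducedT f j r) (inducedW f j r)

  FeasibleSet : (Assignment → Set) → Set
  FeasibleSet F = ∀ g → F g → Feasible g

  Universal : (Assignment → Set) → Set
  Universal F = ∀ i i' → i ∈ U → i' ∈ U →
    (Σ[ f ∈ Assignment ] (Feasible f × f i 1 ≡ f i' 2)) →
    Σ[ g ∈ Assignment ] (F g × g i 1 ≡ g i' 2)

  Arc : (Assignment → Set) → Fin n → Fin n → Set
  Arc F i i' = i ∈ U × i' ∈ U × (Σ[ g ∈ Assignment ] (F g × g i 1 ≡ g i' 2))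

module Submission where

open import Defs
open import Data.Nat using (ℕ; suc; _≤_; _+_; s≤s; z≤n)
open import Data.Fin using (Fin)
open import Data.Fin.Subset using (_∈_; ∣_∣)
open import Data.Product using (_,_)
open import Relation.Binary.PropositionalEquality using (_≡_; trans; sym)

-- Dropping the first weeks of a feasible assignment keeps it feasible, since
-- the induced schedules of the remaining weeks are unchanged. Hence whatever
-- worker j does in weeks r and r + 1 is the behaviour of some feasible
-- assignment in weeks 1 and 2, and universality turns that into an arc.

module _ (I : ExtInstance) where
  open ExtInstance I

  dropWeeks : ℕ → Assignment → Assignment
  dropWeeks m f i t = f i (t + m)

  dropWeeks-feasible : ∀ m f → Feasible f → Feasible (dropWeeks m f)
  dropWeeks-feasible m f feasible j (suc t) _ = feasible j (suc t + m) (s≤s z≤n)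

  universal⇒arc : (F : Assignment → Set) → Universal F →
    (f : Assignment) → Feasible f →
    (i i' : Fin n) → i ∈ U → i' ∈ U → f i 1 ≡ f i' 2 → Arc F i i'
  universal⇒arc F universal f feasible i i' i∈U i'∈U same =
    i∈U , i'∈U , universal i i' i∈U i'∈U (f , feasible , same)

lemma2p2 : (I : ExtInstance) → let open ExtInstance I in
    ∣ U ∣ ≡ q →
    (F : Assignment → Set) → FeasibleSet F → Universal F →
    (f : Assignment) → Feasible f →
    (j : Fin q) → (r : ℕ) → 1 ≤ r →
    (i i' : Fin n) → i ∈ U → i' ∈ U → f i r ≡ j → f i' (suc r) ≡ j →
    Arc F i i'
lemma2p2 I _ F _ universal f feasible j (suc m) _ i i' i∈U i'∈U fir≡j fi'r+1≡j =
  universal⇒arc I F universal (dropWeeks I m f) (dropWeeks-feasible I m f feasible)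
    i i' i∈U i'∈U (trans fir≡j (sym fi'r+1≡j))
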